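{- Let $r_1\ge 2$, $x_1\ge1$ be integers, $d=x_1+r_1-1$, and let $\mathcal{G}\subset K[z_1,\ldots,z_{r_1+3},y_1,\ldots,y_d]$ be the following set of binomials, with $<_{lex}$ the lexicographic order $z_1>\cdots>z_{r_1+3}>y_1>\cdots>y_d$: (1) $z_iz_j-z_kz_\ell$ for all $(i,j)$ with $j-i\ge2$, $1\le i\le r_1$, $j\le r_1+3$, $j\ne r_1+1$, where $k=\lfloor (i+j)/2\rfloor,\ \ell=\lceil (i+j)/2\rceil$ if $j<r_1+1$; $k=\lfloor (i+j-1)/2\rfloor,\ \ell=\lceil (i+j-1)/2\rceil$ if $j=r_1+2$; $k=i+1,\ \ell=r_1+1$ if $j=r_1+3,\ i\ne r_1$; $k=r_1+1,\ \ell=r_1+2$ if $j=r_1+3,\ i=r_1$; (2) $z_{k+1}\prod_{s=1}^{r_1-1}y_s-z_{r_1+1}^{r_1-k}z_{r_1+3}^{k}$, $0\le k\le r_1-1$; (3) if $x_1\ge r_1-2$: $z_{r_1-k}\prod_{s=r_1}^{d}y_s-z_{r_1}^{k}z_{r_1+2}^{x_1+1-k}$, $0\le k\le r_1-1$; if $x_1<r_1-2$: the same binomials for $0\le k\le x_1+1$ together with $z_{r_1-k}\prod_{s=r_1}^{d}y_s-z_{r_1-1}^{k-x_1-1}z_{r_1}^{2x_1+2-k}$ for $x_1+2\le k\le r_1-1$; (4) $z_{r_1+2}\prod_{s=1}^{r_1-1}y_s-z_{r_1+3}^{r_1}$; (5) $z_{r_1+1}\prod_{s=r_1}^{d}y_s-z_{r_1+2}^{x_1}z_{r_1+3}$.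 Let $f=z_1^{\gamma_1}\cdots z_{r_1+3}^{\gamma_{r_1+3}}y_1^{\delta_1}\cdots y_d^{\delta_d}$ be a monomial not lying in the monomial ideal $\mathrm{in}_{<_{lex}}(\mathcal{G})$ generated by the leading terms of the elements of $\mathcal{G}$, and suppose $\gamma_i>0$ for some $i$. Let $m$ be the minimal index with $\gamma_m>0$. Then $|\{i:\gamma_i>0\}|\le 3$, and moreover: (1) if $1\le m\le r_1-1$, then $\gamma_i=0$ for all $i\in\{1,\ldots,r_1+3\}\setminus\{m,m+1,r_1+1\}$; (2) if $m=r_1$, then $\gamma_i=0$ for all $i\in\{1,\ldots,r_1-1\}\cup\{r_1+3\}$; (3) if $m\in\{r_1+1,r_1+2,r_1+3\}$, then $\gamma_i=0$ for all $i<m$.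
   Context: $K$ is a field. The leading term of each binomial with respect to $<_{lex}$ is its first-written monomial. -}

module Defs where

open import Data.Nat using (ℕ; zero; suc; _+_; _*_; _∸_; _≤_; _<_; _≡ᵇ_; _≤ᵇ_; ⌊_/2⌋; ⌈_/2⌉)
open import Data.Bool using (if_then_else_; _∧_)
open import Data.Product using (_×_; _,_; proj₁; proj₂; ∃)
open import Data.List using (List; length; filter; map; upTo)
open import Data.Nat.Properties using (_<?_)
open import Relation.Binary.PropositionalEquality using (_≡_; _≢_)

-- A monomial in z_1..z_{r1+3}, y_1..y_d is given by its exponent functions
-- (z-exponents, y-exponents), indexed 1-based by natural numbers.
Mon : Set
Mon = (ℕ → ℕ) × (ℕ → ℕ)

one : Mon
one = (λ _ → 0) , (λ _ → 0)

_·_ : Mon → Mon → Mon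
(a , b) · (c , d) = (λ i → a i + c i) , (λ s → b s + d s)
infixl 7 _·_

z^ : ℕ → ℕ → Mon
z^ i e = (λ j → if j ≡ᵇ i then e else 0) , (λ _ → 0)

yProd : ℕ → ℕ → Mon
yProd a b = (λ _ → 0) , (λ s → if (a ≤ᵇ s) ∧ (s ≤ᵇ b) then 1 else 0)

_∣ᵐ_ : Mon → Mon → Set
u ∣ᵐ v = (∀ i → proj₁ u i ≤ proj₁ v i) × (∀ s → proj₂ u s ≤ proj₂ v s)

-- A binomial  lead - trail, written with its first-written monomial first.
Binomial : Set
Binomial = Mon × Mon

lead : Binomial → Mon
lead = proj₁

data InG (r1 x1 : ℕ) : Binomial → Set where
  g1a : ∀ i j → 1 ≤ i → i ≤ r1 → i + 2 ≤ j → j < r1 + 1 →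
        InG r1 x1 (z^ i 1 · z^ j 1 , z^ ⌊ i + j /2⌋ 1 · z^ ⌈ i + j /2⌉ 1)
  g1b : ∀ i j → 1 ≤ i → i ≤ r1 → i + 2 ≤ j → j ≡ r1 + 2 →
        InG r1 x1 (z^ i 1 · z^ j 1 , z^ ⌊ i + j ∸ 1 /2⌋ 1 · z^ ⌈ i + j ∸ 1 /2⌉ 1)
  g1c : ∀ i j → 1 ≤ i → i ≤ r1 → i + 2 ≤ j → j ≡ r1 + 3 → i ≢ r1 →
        InG r1 x1 (z^ i 1 · z^ j 1 , z^ (i + 1) 1 · z^ (r1 + 1) 1)
  g1d : ∀ i j → 1 ≤ i → i ≤ r1 → i + 2 ≤ j → j ≡ r1 + 3 → i ≡ r1 →
        InG r1 x1 (z^ i 1 · z^ j 1 , z^ (r1 + 1) 1 · z^ (r1 + 2) 1)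
  g2 : ∀ k → k ≤ r1 ∸ 1 →
       InG r1 x1 (z^ (k + 1) 1 · yProd 1 (r1 ∸ 1) ,
                  z^ (r1 + 1) (r1 ∸ k) · z^ (r1 + 3) k)
  g3a : ∀ k → r1 ∸ 2 ≤ x1 → k ≤ r1 ∸ 1 →
        InG r1 x1 (z^ (r1 ∸ k) 1 · yProd r1 (x1 + r1 ∸ 1) ,
                   z^ r1 k · z^ (r1 + 2) (x1 + 1 ∸ k))
  g3b : ∀ k → x1 < r1 ∸ 2 → k ≤ x1 + 1 →
        InG r1 x1 (z^ (r1 ∸ k) 1 · yProd r1 (x1 + r1 ∸ 1) ,
                   z^ r1 k · z^ (r1 + 2) (x1 + 1 ∸ k))
  g3c : ∀ k → x1 < r1 ∸ 2 → x1 + 2 ≤ k → k ≤ r1 ∸ 1 →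
        InG r1 x1 (z^ (r1 ∸ k) 1 · yProd r1 (x1 + r1 ∸ 1) ,
                   z^ (r1 ∸ 1) (k ∸ (x1 + 1)) · z^ r1 (2 + 2 * x1 ∸ k))
  g4 : InG r1 x1 (z^ (r1 + 2) 1 · yProd 1 (r1 ∸ 1) , z^ (r1 + 3) r1)
  g5 : InG r1 x1 (z^ (r1 + 1) 1 · yProd r1 (x1 + r1 ∸ 1) ,
                  z^ (r1 + 2) x1 · z^ (r1 + 3) 1)

InInitial : ℕ → ℕ → Mon → Set
InInitial r1 x1 f = ∃ λ b → InG r1 x1 b × (lead b ∣ᵐ f)

supportSize : ℕ → (ℕ → ℕ) → ℕ
supportSize n γ = length (filter (λ i → 0 <? γ i) (map suc (upTo n)))

{-# OPTIONS --safe #-}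
-- Only the quadratic binomials of type (1) matter.  For 1 ≤ i ≤ r1 and
-- i + 2 ≤ j ≤ r1 + 3 with j ≠ r1 + 1 the product z_i z_j is a leading term,
-- so a monomial outside in(𝒢) never involves both z_i and z_j.  Hence, if
-- m ≤ r1, every z-variable of f other than z_m and z_{m+1} is z_{r1+1}; and
-- if m > r1 only z_{r1+1}, z_{r1+2}, z_{r1+3} are left.  Either way the
-- support lies in a three-element set.
module Submission where

open import Defs
open import Data.Nat using (ℕ; zero; suc; _+_; _∸_; _≤_; _<_; z≤n; s≤s; _≡ᵇ_)
open import Data.Nat.Properties
open import Data.Bool using (true; false)
open import Data.Product using (_×_; _,_; proj₁; proj₂; ∃)
open import Data.Sum using (_⊎_; inj₁; inj₂)
open import Data.List using (List; []; _∷_; [_]; _++_; length; filter; map; upTo)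
open import Data.List.Properties using (length-++)
open import Data.List.Membership.Propositional using (_∈_)
open import Data.List.Membership.Propositional.Properties
  using (∈-∃++; ∈-++⁻; ∈-++⁺ˡ; ∈-++⁺ʳ; ∈-filter⁻; ∈-map⁺)
open import Data.List.Relation.Binary.Subset.Propositional using (_⊆_)
open import Data.List.Relation.Unary.Any using (here; there)
open import Data.List.Relation.Unary.All using (lookup)
open import Data.List.Relation.Unary.AllPairs using (_∷_)
open import Data.List.Relation.Unary.Unique.Propositional using (Unique)
import Data.List.Relation.Unary.Unique.Propositional.Properties as Unique
open import Data.Empty using (⊥-elim)
open import Relation.Nullary using (¬_; yes; no)
open import Relation.Unary using (Decidable)
open import Relation.Binary.PropositionalEquality using (_≡_; _≢_; refl; sym; cong; subst)
open import Function using (_∘′_; case_of_)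

unique⊆⇒length≤ : ∀ {A : Set} {xs ys : List A} → Unique xs → xs ⊆ ys → length xs ≤ length ys
unique⊆⇒length≤ {xs = []} _ _ = z≤n
unique⊆⇒length≤ {xs = x ∷ xs} (x∉xs ∷ xs!) x∷xs⊆ys with ∈-∃++ (x∷xs⊆ys (here refl))
... | us , vs , refl = begin
  suc (length xs)              ≤⟨ s≤s (unique⊆⇒length≤ xs! xs⊆us++vs) ⟩
  suc (length (us ++ vs))      ≡⟨ cong suc (length-++ us) ⟩
  suc (length us + length vs)  ≡⟨ +-suc (length us) (length vs) ⟨
  length us + length (x ∷ vs)  ≡⟨ length-++ us ⟨
  length (us ++ [ x ] ++ vs)   ∎
  where
  open ≤-Reasoning
  xs⊆us++vs : xs ⊆ us ++ vs
  xs⊆us++vs y∈xs with ∈-++⁻ us (x∷xs⊆ys (there y∈xs))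
  ... | inj₁ y∈us          = ∈-++⁺ˡ y∈us
  ... | inj₂ (here y≡x)    = ⊥-elim (lookup x∉xs y∈xs (sym y≡x))
  ... | inj₂ (there y∈vs)  = ∈-++⁺ʳ us y∈vs

supportSize≤length : ∀ n (γ : ℕ → ℕ) {ys : List ℕ} →
  (∀ {i} → 0 < γ i → i ∈ ys) → supportSize n γ ≤ length ys
supportSize≤length n γ support⊆ys =
  unique⊆⇒length≤ (Unique.filter⁺ positive? {xs = indices} (Unique.map⁺ suc-injective (Unique.upTo⁺ n)))
                  (λ i∈support → support⊆ys (proj₂ (∈-filter⁻ positive? {xs = indices} i∈support)))
  where
  positive? : Decidable (λ i → 0 < γ i)
  positive? i = 0 <? γ i
  indices : List ℕ
  indices = map suc (upTo n)

∈-top-three : ∀ n {j} → n < j → j ≤ n + 3 → j ∈ n + 1 ∷ n + 2 ∷ n + 3 ∷ []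
∈-top-three zero {1} _ _ = here refl
∈-top-three zero {2} _ _ = there (here refl)
∈-top-three zero {3} _ _ = there (there (here refl))
∈-top-three zero {suc (suc (suc (suc _)))} _ (s≤s (s≤s (s≤s ())))
∈-top-three (suc n) {suc j} (s≤s n<j) (s≤s j≤n+3) = ∈-map⁺ suc (∈-top-three n n<j j≤n+3)

≤∧≢∧≢⇒+2≤ : ∀ m {n} → m ≤ n → n ≢ m → n ≢ m + 1 → m + 2 ≤ n
≤∧≢∧≢⇒+2≤ zero {0} _ n≢0 _ = ⊥-elim (n≢0 refl)
≤∧≢∧≢⇒+2≤ zero {1} _ _ n≢1 = ⊥-elim (n≢1 refl)
≤∧≢∧≢⇒+2≤ zero {suc (suc _)} _ _ _ = s≤s (s≤s z≤n)
≤∧≢∧≢⇒+2≤ (suc m) {suc n} (s≤s m≤n) n≢m n≢m+1 =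
  s≤s (≤∧≢∧≢⇒+2≤ m m≤n (n≢m ∘′ cong suc) (n≢m+1 ∘′ cong suc))

z^-diag : ∀ i e → proj₁ (z^ i e) i ≡ e
z^-diag i e with i ≡ᵇ i | ≡⇒≡ᵇ i i refl
... | true | _ = refl

z^-offdiag : ∀ {i k} e → k ≢ i → proj₁ (z^ i e) k ≡ 0
z^-offdiag {i} {k} e k≢i with k ≡ᵇ i | ≡ᵇ⇒≡ k i
... | false | _   = refl
... | true  | k≡i = ⊥-elim (k≢i (k≡i _))

zᵢzⱼ∣ᵐ : ∀ {i j} (γ δ : ℕ → ℕ) → i ≢ j → 0 < γ i → 0 < γ j → (z^ i 1 · z^ j 1) ∣ᵐ (γ , δ)
zᵢzⱼ∣ᵐ {i} {j} γ δ i≢j 0<γi 0<γj = exponent≤ , λ _ → z≤n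
  where
  exponent≤ : ∀ k → proj₁ (z^ i 1) k + proj₁ (z^ j 1) k ≤ γ k
  exponent≤ k with k ≟ i | k ≟ j
  ... | yes refl | yes refl = ⊥-elim (i≢j refl)
  ... | yes refl | no k≢j rewrite z^-diag i 1 | z^-offdiag 1 k≢j = 0<γi
  ... | no k≢i | yes refl rewrite z^-offdiag 1 k≢i | z^-diag j 1 = 0<γj
  ... | no k≢i | no k≢j rewrite z^-offdiag 1 k≢i | z^-offdiag 1 k≢j = z≤n

zᵢzⱼ-lead∈𝒢 : ∀ {r1 x1 i j} → 1 ≤ i → i ≤ r1 → i + 2 ≤ j → j ≤ r1 + 3 → j ≢ r1 + 1 →
  ∃ λ trail → InG r1 x1 (z^ i 1 · z^ j 1 , trail)
zᵢzⱼ-lead∈𝒢 {r1} {i = i} {j} 1≤i i≤r1 i+2≤j j≤r1+3 j≢r1+1 with j ≤? r1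
... | yes j≤r1 = _ , g1a i j 1≤i i≤r1 i+2≤j (subst (j <_) (+-comm 1 r1) (s≤s j≤r1))
... | no j≰r1 with ∈-top-three r1 (≰⇒> j≰r1) j≤r1+3
...   | here j≡r1+1                = ⊥-elim (j≢r1+1 j≡r1+1)
...   | there (here j≡r1+2)        = _ , g1b i j 1≤i i≤r1 i+2≤j j≡r1+2
...   | there (there (here j≡r1+3)) with i ≟ r1
...     | yes i≡r1 = _ , g1d i j 1≤i i≤r1 i+2≤j j≡r1+3 i≡r1
...     | no i≢r1  = _ , g1c i j 1≤i i≤r1 i+2≤j j≡r1+3 i≢r1

standard-support-gap : ∀ {r1 x1 i j} {γ δ : ℕ → ℕ} → ¬ InInitial r1 x1 (γ , δ) →
  1 ≤ i → i ≤ r1 → i + 2 ≤ j → j ≤ r1 + 3 → 0 < γ i → 0 < γ j → j ≡ r1 + 1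
standard-support-gap {r1} {i = i} {j} {γ} {δ} f∉in 1≤i i≤r1 i+2≤j j≤r1+3 0<γi 0<γj
  with j ≟ r1 + 1
... | yes j≡r1+1 = j≡r1+1
... | no j≢r1+1 with zᵢzⱼ-lead∈𝒢 1≤i i≤r1 i+2≤j j≤r1+3 j≢r1+1
...   | _ , g∈𝒢 = ⊥-elim (f∉in (_ , g∈𝒢 , zᵢzⱼ∣ᵐ γ δ i≢j 0<γi 0<γj))
  where
  i≢j : i ≢ j
  i≢j refl = m+1+n≰m i i+2≤j

standard-support-if-m≤r1 : ∀ {r1 x1 m i} {γ δ : ℕ → ℕ} → ¬ InInitial r1 x1 (γ , δ) →
  1 ≤ m → m ≤ r1 → 0 < γ m → m ≤ i × i ≤ r1 + 3 → 0 < γ i → i ∈ m ∷ m + 1 ∷ r1 + 1 ∷ []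
standard-support-if-m≤r1 {m = m} {i} f∉in 1≤m m≤r1 0<γm (m≤i , i≤r1+3) 0<γi with i ≟ m | i ≟ m + 1
... | yes i≡m | _          = here i≡m
... | no _    | yes i≡m+1  = there (here i≡m+1)
... | no i≢m  | no i≢m+1   = there (there (here
  (standard-support-gap f∉in 1≤m m≤r1 (≤∧≢∧≢⇒+2≤ m m≤i i≢m i≢m+1) i≤r1+3 0<γm 0<γi)))

standard-supportSize≤3 : ∀ {r1 x1 m} {γ δ : ℕ → ℕ} → ¬ InInitial r1 x1 (γ , δ) →
  1 ≤ m → 0 < γ m → (∀ {i} → 0 < γ i → m ≤ i × i ≤ r1 + 3) → supportSize (r1 + 3) γ ≤ 3
standard-supportSize≤3 {r1} {m = m} {γ} f∉in 1≤m 0<γm support-bounds with m ≤? r1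
... | yes m≤r1 = supportSize≤length (r1 + 3) γ λ 0<γi →
  standard-support-if-m≤r1 f∉in 1≤m m≤r1 0<γm (support-bounds 0<γi) 0<γi
... | no m≰r1  = supportSize≤length (r1 + 3) γ λ 0<γi →
  ∈-top-three r1 (<-≤-trans (≰⇒> m≰r1) (proj₁ (support-bounds 0<γi))) (proj₂ (support-bounds 0<γi))

support-between : ∀ (γ : ℕ → ℕ) {m n i} → γ 0 ≡ 0 → (∀ i → n < i → γ i ≡ 0) →
  (∀ i → 1 ≤ i → i < m → γ i ≡ 0) → 0 < γ i → m ≤ i × i ≤ n
support-between γ {m} {i = i} γ₀≡0 vanishes-above vanishes-below 0<γi =
  ≮⇒≥ (λ i<m → <-irrefl (sym (vanishes-from-below i i<m)) 0<γi) ,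
  ≮⇒≥ (λ n<i → <-irrefl (sym (vanishes-above i n<i)) 0<γi)
  where
  vanishes-from-below : ∀ j → j < m → γ j ≡ 0
  vanishes-from-below zero    _ = γ₀≡0
  vanishes-from-below (suc j)   = vanishes-below (suc j) (s≤s z≤n)

¬0<⇒≡0 : ∀ {n} → ¬ 0 < n → n ≡ 0
¬0<⇒≡0 0≮n = n≤0⇒n≡0 (≮⇒≥ 0≮n)

lemma3p4 : (r1 x1 : ℕ) → 2 ≤ r1 → 1 ≤ x1 →
    (γ δ : ℕ → ℕ) →
    γ 0 ≡ 0 → (∀ i → r1 + 3 < i → γ i ≡ 0) →
    δ 0 ≡ 0 → (∀ s → x1 + r1 ∸ 1 < s → δ s ≡ 0) →
    ¬ InInitial r1 x1 (γ , δ) →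
    (m : ℕ) → 1 ≤ m → m ≤ r1 + 3 → 0 < γ m →
    (∀ i → 1 ≤ i → i < m → γ i ≡ 0) →
    (supportSize (r1 + 3) γ ≤ 3)
    × (m ≤ r1 ∸ 1 → ∀ i → 1 ≤ i → i ≤ r1 + 3 →
         i ≢ m → i ≢ m + 1 → i ≢ r1 + 1 → γ i ≡ 0)
    × (m ≡ r1 → ∀ i → ((1 ≤ i × i ≤ r1 ∸ 1) ⊎ i ≡ r1 + 3) → γ i ≡ 0)
    × (r1 + 1 ≤ m → ∀ i → 1 ≤ i → i < m → γ i ≡ 0)
lemma3p4 r1 x1 2≤r1 _ γ δ γ₀≡0 vanishes-above _ _ f∉in m 1≤m _ 0<γm vanishes-below =
  standard-supportSize≤3 f∉in 1≤m 0<γm support-bounds , case-m<r1 , case-m≡r1 , λ _ → vanishes-below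
  where
  1≤r1 : 1 ≤ r1
  1≤r1 = ≤-trans (s≤s z≤n) 2≤r1

  support-bounds : ∀ {i} → 0 < γ i → m ≤ i × i ≤ r1 + 3
  support-bounds = support-between γ γ₀≡0 vanishes-above vanishes-below

  case-m<r1 : m ≤ r1 ∸ 1 → ∀ i → 1 ≤ i → i ≤ r1 + 3 → i ≢ m → i ≢ m + 1 → i ≢ r1 + 1 → γ i ≡ 0
  case-m<r1 m≤r1-1 i _ _ i≢m i≢m+1 i≢r1+1 = ¬0<⇒≡0 λ 0<γi →
    case standard-support-if-m≤r1 f∉in 1≤m (≤-trans m≤r1-1 (m∸n≤m r1 1)) 0<γm
           (support-bounds 0<γi) 0<γi of λ
      { (here i≡m) → i≢m i≡m
      ; (there (here i≡m+1)) → i≢m+1 i≡m+1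
      ; (there (there (here i≡r1+1))) → i≢r1+1 i≡r1+1 }

  case-m≡r1 : m ≡ r1 → ∀ i → ((1 ≤ i × i ≤ r1 ∸ 1) ⊎ i ≡ r1 + 3) → γ i ≡ 0
  case-m≡r1 m≡r1 i (inj₁ (1≤i , i≤r1-1)) =
    vanishes-below i 1≤i (subst (i <_) (sym m≡r1) (≤-<-trans i≤r1-1 (∸-monoʳ-< (s≤s z≤n) 1≤r1)))
  case-m≡r1 m≡r1 .(r1 + 3) (inj₂ refl) = ¬0<⇒≡0 λ 0<γr1+3 →
    case +-cancelˡ-≡ r1 3 1 (standard-support-gap f∉in 1≤r1 ≤-refl (+-monoʳ-≤ r1 (n≤1+n 2)) ≤-refl
                                (subst (λ k → 0 < γ k) m≡r1 0<γm) 0<γr1+3) of λ ()
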